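{- Let $G$ be a finite abelian group and $k\ge 0$ an integer. If $G$ is not $k$-close, then there exist a block matroid $M=(E,\mathcal{I})$ of rank $k+1$ with blocks $A$ and $B$, a $G$-labeling $\ell:E\to G$ and an element $g\in G$ such that $B$ is a $g$-base, $B$ is closest to $A$ among all $g$-bases of $M$, and $|A\setminus B|>k$.
   Context: Matroids are finite and loopless. A block matroid is a matroid whose ground set is the union of two disjoint bases, called blocks. A $G$-labeling is a map $\ell:E\to G$; $\ell(F)=\sum_{e\in F}\ell(e)$. A $g$-base is a base $B$ with $\ell(B)=g$. The distance between bases $A,B$ is $|A\setminus B|$. A $G$-labeling $\ell$ of $M$ is $k$-close if for every $g\in G$ for which a $g$-base exists, every base has a $g$-base at distance at most $k$ from it; $G$ is $k$-close if every $G$-labeling of every matroid is $k$-close. -}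

module Defs where

open import Level using (Level; _⊔_) renaming (suc to lsuc; zero to lzero)
open import Data.Nat using (ℕ; zero; suc; _≤_; _<_)
open import Data.Fin using (Fin; zero; suc)
open import Data.Fin.Subset using (Subset; _∈_; _∉_; _⊆_; _⊂_; _∪_; _∩_; _─_; ⁅_⁆; ∣_∣; ⊥; ⊤; inside; outside)
open import Data.Vec using (_∷_; [])
open import Data.Product using (Σ; ∃; _×_; _,_)
open import Relation.Nullary using (¬_)
open import Relation.Nullary.Decidable using (Dec)
open import Relation.Binary.PropositionalEquality using (_≡_)
open import Algebra.Bundles using (AbelianGroup)

-- A finite loopless matroid on the ground set E = Fin n, given by its
-- independent sets (M = (E, 𝓘)).  Independence is decidable (automatic
-- classically for a finite ground set).
record Matroid (n : ℕ) : Set₁ where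
  field
    Indep       : Subset n → Set
    indep?      : (X : Subset n) → Dec (Indep X)
    indep-∅     : Indep ⊥
    indep-⊆     : ∀ {X Y} → X ⊆ Y → Indep Y → Indep X
    augment     : ∀ {X Y} → Indep X → Indep Y → ∣ X ∣ < ∣ Y ∣ →
                  ∃ λ y → y ∈ Y × y ∉ X × Indep (X ∪ ⁅ y ⁆)
    loopless    : ∀ (x : Fin n) → Indep ⁅ x ⁆

module _ {n : ℕ} (M : Matroid n) where
  open Matroid M

  IsBase : Subset n → Set
  IsBase X = Indep X × (∀ Y → X ⊂ Y → ¬ Indep Y)

  HasRank : ℕ → Set
  HasRank r = ∀ X → IsBase X → ∣ X ∣ ≡ r

  IsBlockMatroidWithBlocks : Subset n → Subset n → Set
  IsBlockMatroidWithBlocks A B =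
    IsBase A × IsBase B × (A ∩ B ≡ ⊥) × (A ∪ B ≡ ⊤)

  dist : Subset n → Subset n → ℕ
  dist A B = ∣ A ─ B ∣

module _ {c ℓ : Level} (G : AbelianGroup c ℓ) where
  open AbelianGroup G renaming (Carrier to ∣G∣)

  record IsFinite : Set (c ⊔ ℓ) where
    field
      size   : ℕ
      enum   : Fin size → ∣G∣
      onto   : ∀ x → ∃ λ i → enum i ≈ x
      inject : ∀ i j → enum i ≈ enum j → i ≡ j

  labelSum : ∀ {n} → (Fin n → ∣G∣) → Subset n → ∣G∣
  labelSum {zero}  lab []            = ε
  labelSum {suc n} lab (inside  ∷ F) = lab zero ∙ labelSum (λ i → lab (suc i)) F
  labelSum {suc n} lab (outside ∷ F) = labelSum (λ i → lab (suc i)) F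

  module _ {n : ℕ} (M : Matroid n) (lab : Fin n → ∣G∣) where

    IsGBase : ∣G∣ → Subset n → Set ℓ
    IsGBase g X = IsBase M X × labelSum lab X ≈ g

    ClosestGBase : ∣G∣ → Subset n → Subset n → Set ℓ
    ClosestGBase g A B =
      IsGBase g B × (∀ B′ → IsGBase g B′ → dist M A B ≤ dist M A B′)

    KCloseLabeling : ℕ → Set (c ⊔ ℓ)
    KCloseLabeling k =
      ∀ (g : ∣G∣) → (∃ λ X → IsGBase g X) →
      ∀ A → IsBase M A → ∃ λ B → IsGBase g B × dist M A B ≤ k

  KClose : ℕ → Set (lsuc lzero ⊔ c ⊔ ℓ)
  KClose k = ∀ (n : ℕ) (M : Matroid n) (lab : Fin n → ∣G∣) → KCloseLabeling M lab k

  NotKClose : ℕ → Set (lsuc lzero ⊔ c ⊔ ℓ)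
  NotKClose k = Σ ℕ λ n → Σ (Matroid n) λ M → Σ (Fin n → ∣G∣) λ lab →
                ¬ KCloseLabeling M lab k

-- Let ℓ be a labeling that is not k-close: some g-base exists, yet some base A is at distance
-- more than k from every g-base; let B be a g-base closest to A.  Basis exchange yields a base T
-- with A ∩ B ⊆ T ⊆ A ∪ B and ∣T ─ B∣ = k + 1.  Contracting T ∩ B and restricting to the symmetric
-- difference of T and B gives a block matroid of rank k + 1 with blocks T ─ B and B ─ T.  With the
-- labels restricted and g shifted by ℓ(T ∩ B), a g′-base Y of this minor lifts to the g-base
-- Y ∪ (T ∩ B) of M, whose distance to A is at most ∣(T ─ B) ─ Y∣ + (∣A ─ B∣ − k − 1); since B is
-- closest to A this forces ∣(T ─ B) ─ Y∣ ≥ k + 1.  Hence B ─ T is a g′-base closest to T ─ B,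
-- at distance k + 1.
module Submission where

open import Defs
open import Level using (Level; 0ℓ; _⊔_) renaming (suc to lsuc)
open import Algebra.Bundles using (AbelianGroup; CommutativeMonoid; Group)
import Algebra.Properties.CommutativeSemigroup as CommutativeSemigroupProperties
import Algebra.Properties.Group as GroupProperties
open import Data.Empty using (⊥-elim)
open import Data.Fin using (Fin; zero; suc)
open import Data.Fin.Properties using (_≟_)
open import Data.Fin.Subset
open import Data.Fin.Subset.Properties
open import Data.Nat using (ℕ; zero; suc; _+_; _∸_; _≤_; _<_; z≤n; s≤s; _≤?_; _<?_)
open import Data.Nat.Induction using (<-wellFounded)
open import Data.Nat.Properties
  using (module ≤-Reasoning; +-suc; +-comm; +-assoc; +-identityʳ; ≤-trans; ≤-antisym; ≤-reflexive; n≤1+n; +-monoʳ-≤;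
         +-monoˡ-<; +-cancelˡ-≡; +-cancelʳ-≤; <⇒≱; ≮⇒≥; ≰⇒>; m∸n≤m; m∸n+n≡m; m+[n∸m]≡n)
open import Data.Product using (Σ; ∃; _×_; _,_; proj₁; proj₂)
open import Data.Sum using (inj₁; inj₂)
open import Data.Vec using (_∷_; [])
open import Data.Vec.Base using (here; there)
open import Function using (_∘_; id)
open import Induction.WellFounded using (Acc; acc)
open import Relation.Nullary using (¬_; Dec; yes; no)
open import Relation.Nullary.Decidable using (_×-dec_; ¬?; map′; decidable-stable)
open import Relation.Binary.PropositionalEquality as ≡ using (_≡_; refl; cong; subst; subst₂)

Disjoint : ∀ {n} → Subset n → Subset n → Set
Disjoint p q = ∀ {x} → x ∈ p → x ∉ q

Disjoint-tail : ∀ {n s t} {p q : Subset n} → Disjoint (s ∷ p) (t ∷ q) → Disjoint p q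
Disjoint-tail p#q x∈p x∈q = p#q (there x∈p) (there x∈q)

Disjoint-∪ : ∀ {n} {p q r : Subset n} → Disjoint p r → Disjoint q r → Disjoint (p ∪ q) r
Disjoint-∪ {p = p} {q} p#r q#r x∈p∪q with x∈p∪q⁻ p q x∈p∪q
... | inj₁ x∈p = p#r x∈p
... | inj₂ x∈q = q#r x∈q

Disjoint⇒p∩q≡⊥ : ∀ {n} {p q : Subset n} → Disjoint p q → p ∩ q ≡ ⊥
Disjoint⇒p∩q≡⊥ {p = p} {q} p#q = Empty-unique λ (x , x∈p∩q) →
  let x∈p , x∈q = x∈p∩q⁻ p q x∈p∩q in p#q x∈p x∈q

x∈p─q⇒x∉q : ∀ {n} {p q : Subset n} {x} → x ∈ p ─ q → x ∉ q
x∈p─q⇒x∉q {p = inside ∷ _} {outside ∷ _} here ()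
x∈p─q⇒x∉q {p = _ ∷ _} {_ ∷ _} (there x∈p─q) (there x∈q) = x∈p─q⇒x∉q x∈p─q x∈q

p∪q⊆r : ∀ {n} {p q r : Subset n} → p ⊆ r → q ⊆ r → p ∪ q ⊆ r
p∪q⊆r {p = p} {q} p⊆r q⊆r x∈p∪q with x∈p∪q⁻ p q x∈p∪q
... | inj₁ x∈p = p⊆r x∈p
... | inj₂ x∈q = q⊆r x∈q

x∈p⇒⁅x⁆⊆p : ∀ {n} {p : Subset n} {x} → x ∈ p → ⁅ x ⁆ ⊆ p
x∈p⇒⁅x⁆⊆p {p = p} {x} x∈p y∈⁅x⁆ = subst (_∈ p) (≡.sym (x∈⁅y⁆⇒x≡y x y∈⁅x⁆)) x∈p

x∉p⇒p⊂p∪⁅x⁆ : ∀ {n} {p : Subset n} {x} → x ∉ p → p ⊂ p ∪ ⁅ x ⁆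
x∉p⇒p⊂p∪⁅x⁆ {p = p} {x} x∉p = p⊆p∪q ⁅ x ⁆ , x , q⊆p∪q p ⁅ x ⁆ (x∈⁅x⁆ x) , x∉p

p─q∪p∩q≡p : ∀ {n} (p q : Subset n) → (p ─ q) ∪ (p ∩ q) ≡ p
p─q∪p∩q≡p []            []            = refl
p─q∪p∩q≡p (inside  ∷ p) (inside  ∷ q) = cong (inside ∷_) (p─q∪p∩q≡p p q)
p─q∪p∩q≡p (inside  ∷ p) (outside ∷ q) = cong (inside ∷_) (p─q∪p∩q≡p p q)
p─q∪p∩q≡p (outside ∷ p) (inside  ∷ q) = cong (outside ∷_) (p─q∪p∩q≡p p q)
p─q∪p∩q≡p (outside ∷ p) (outside ∷ q) = cong (outside ∷_) (p─q∪p∩q≡p p q)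

∣p∪q∣≡∣p∣+∣q∣ : ∀ {n} (p q : Subset n) → Disjoint p q → ∣ p ∪ q ∣ ≡ ∣ p ∣ + ∣ q ∣
∣p∪q∣≡∣p∣+∣q∣ []            []            _   = refl
∣p∪q∣≡∣p∣+∣q∣ (inside  ∷ p) (inside  ∷ q) p#q = ⊥-elim (p#q here here)
∣p∪q∣≡∣p∣+∣q∣ (inside  ∷ p) (outside ∷ q) p#q = cong suc (∣p∪q∣≡∣p∣+∣q∣ p q (Disjoint-tail p#q))
∣p∪q∣≡∣p∣+∣q∣ (outside ∷ p) (inside  ∷ q) p#q =
  ≡.trans (cong suc (∣p∪q∣≡∣p∣+∣q∣ p q (Disjoint-tail p#q))) (≡.sym (+-suc ∣ p ∣ ∣ q ∣))
∣p∪q∣≡∣p∣+∣q∣ (outside ∷ p) (outside ∷ q) p#q = ∣p∪q∣≡∣p∣+∣q∣ p q (Disjoint-tail p#q)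

∣p∪q∣≤∣p∣+∣q∣ : ∀ {n} (p q : Subset n) → ∣ p ∪ q ∣ ≤ ∣ p ∣ + ∣ q ∣
∣p∪q∣≤∣p∣+∣q∣ []            []            = z≤n
∣p∪q∣≤∣p∣+∣q∣ (inside  ∷ p) (inside  ∷ q) =
  s≤s (≤-trans (∣p∪q∣≤∣p∣+∣q∣ p q) (+-monoʳ-≤ ∣ p ∣ (n≤1+n ∣ q ∣)))
∣p∪q∣≤∣p∣+∣q∣ (inside  ∷ p) (outside ∷ q) = s≤s (∣p∪q∣≤∣p∣+∣q∣ p q)
∣p∪q∣≤∣p∣+∣q∣ (outside ∷ p) (inside  ∷ q) =
  ≤-trans (s≤s (∣p∪q∣≤∣p∣+∣q∣ p q)) (≤-reflexive (≡.sym (+-suc ∣ p ∣ ∣ q ∣)))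
∣p∪q∣≤∣p∣+∣q∣ (outside ∷ p) (outside ∷ q) = ∣p∪q∣≤∣p∣+∣q∣ p q

∣p∣≡∣p∩q∣+∣p─q∣ : ∀ {n} (p q : Subset n) → ∣ p ∣ ≡ ∣ p ∩ q ∣ + ∣ p ─ q ∣
∣p∣≡∣p∩q∣+∣p─q∣ p q = begin
  ∣ p ∣                   ≡⟨ cong ∣_∣ (p─q∪p∩q≡p p q) ⟨
  ∣ (p ─ q) ∪ (p ∩ q) ∣   ≡⟨ ∣p∪q∣≡∣p∣+∣q∣ (p ─ q) (p ∩ q) (λ x∈p─q x∈p∩q → x∈p─q⇒x∉q x∈p─q (p∩q⊆q p q x∈p∩q)) ⟩
  ∣ p ─ q ∣ + ∣ p ∩ q ∣   ≡⟨ +-comm ∣ p ─ q ∣ ∣ p ∩ q ∣ ⟩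
  ∣ p ∩ q ∣ + ∣ p ─ q ∣   ∎
  where open ≡.≡-Reasoning

∣p∪⁅x⁆∣≡1+∣p∣ : ∀ {n} {p : Subset n} {x} → x ∉ p → ∣ p ∪ ⁅ x ⁆ ∣ ≡ suc ∣ p ∣
∣p∪⁅x⁆∣≡1+∣p∣ {p = p} {x} x∉p = begin
  ∣ p ∪ ⁅ x ⁆ ∣       ≡⟨ ∣p∪q∣≡∣p∣+∣q∣ p ⁅ x ⁆ (λ y∈p y∈⁅x⁆ → x∉p (subst (_∈ p) (x∈⁅y⁆⇒x≡y x y∈⁅x⁆) y∈p)) ⟩
  ∣ p ∣ + ∣ ⁅ x ⁆ ∣   ≡⟨ cong (∣ p ∣ +_) (∣⁅x⁆∣≡1 x) ⟩
  ∣ p ∣ + 1           ≡⟨ +-comm ∣ p ∣ 1 ⟩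
  suc ∣ p ∣           ∎
  where open ≡.≡-Reasoning

subset-of-size : ∀ {n} (p : Subset n) m → m ≤ ∣ p ∣ → ∃ λ q → q ⊆ p × ∣ q ∣ ≡ m
subset-of-size {n} p zero _ = ⊥ , ⊥⊆ , ∣⊥∣≡0 n
subset-of-size (inside ∷ p) (suc m) (s≤s m≤∣p∣) =
  let q , q⊆p , ∣q∣≡m = subset-of-size p m m≤∣p∣ in inside ∷ q , s⊆s q⊆p , cong suc ∣q∣≡m
subset-of-size (outside ∷ p) (suc m) 1+m≤∣p∣ =
  let q , q⊆p , ∣q∣≡1+m = subset-of-size p (suc m) 1+m≤∣p∣ in outside ∷ q , out⊆ q⊆p , ∣q∣≡1+m

module MatroidProperties {n : ℕ} (M : Matroid n) where
  open Matroid M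

  indep-of-max-size⇒base : ∀ {X} → Indep X → (∀ {Y} → Indep Y → ∣ Y ∣ ≤ ∣ X ∣) → IsBase M X
  indep-of-max-size⇒base iX max = iX , λ Y X⊂Y iY → <⇒≱ (p⊂q⇒∣p∣<∣q∣ X⊂Y) (max iY)

  ∣indep∣≤∣base∣ : ∀ {B X} → IsBase M B → Indep X → ∣ X ∣ ≤ ∣ B ∣
  ∣indep∣≤∣base∣ (iB , B-maximal) iX = ≮⇒≥ λ ∣B∣<∣X∣ →
    let y , _ , y∉B , iB∪y = augment iB iX ∣B∣<∣X∣ in B-maximal _ (x∉p⇒p⊂p∪⁅x⁆ y∉B) iB∪y

  ∣base∣≡∣base∣ : ∀ {B B′} → IsBase M B → IsBase M B′ → ∣ B ∣ ≡ ∣ B′ ∣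
  ∣base∣≡∣base∣ bB bB′ = ≤-antisym (∣indep∣≤∣base∣ bB′ (proj₁ bB)) (∣indep∣≤∣base∣ bB (proj₁ bB′))

  indep-of-base-size⇒base : ∀ {B X} → IsBase M B → Indep X → ∣ X ∣ ≡ ∣ B ∣ → IsBase M X
  indep-of-base-size⇒base bB iX ∣X∣≡∣B∣ =
    indep-of-max-size⇒base iX λ iY → ≤-trans (∣indep∣≤∣base∣ bB iY) (≤-reflexive (≡.sym ∣X∣≡∣B∣))

  extend-by : ∀ m {X J} → Indep X → Indep J → ∣ X ∣ + m ≤ ∣ J ∣ →
              ∃ λ T → Indep T × X ⊆ T × T ⊆ X ∪ J × ∣ T ∣ ≡ ∣ X ∣ + m
  extend-by zero {X} iX _ _ = X , iX , id , p⊆p∪q _ , ≡.sym (+-identityʳ ∣ X ∣)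
  extend-by (suc m) {X} {J} iX iJ ∣X∣+1+m≤∣J∣ =
    let T , iT , X⊆T , T⊆X∪J , ∣T∣≡∣X∣+m = extend-by m iX iJ (≤-trans (+-monoʳ-≤ ∣ X ∣ (n≤1+n m)) ∣X∣+1+m≤∣J∣)
        ∣T∣<∣J∣ = ≤-trans (≤-reflexive (≡.trans (cong suc ∣T∣≡∣X∣+m) (≡.sym (+-suc ∣ X ∣ m)))) ∣X∣+1+m≤∣J∣
        y , y∈J , y∉T , iT∪y = augment iT iJ ∣T∣<∣J∣
    in T ∪ ⁅ y ⁆ , iT∪y , ⊆-trans X⊆T (p⊆p∪q _) ,
       p∪q⊆r T⊆X∪J (⊆-trans (x∈p⇒⁅x⁆⊆p y∈J) (q⊆p∪q X J)) ,
       ≡.trans (∣p∪⁅x⁆∣≡1+∣p∣ y∉T) (≡.trans (cong suc ∣T∣≡∣X∣+m) (≡.sym (+-suc ∣ X ∣ m)))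

  extend-to-base : ∀ {B X} → IsBase M B → Indep X → ∃ λ T → IsBase M T × X ⊆ T × T ⊆ X ∪ B
  extend-to-base {B} {X} bB iX =
    let T , iT , X⊆T , T⊆X∪B , ∣T∣≡∣B∣ = extend-by (∣ B ∣ ∸ ∣ X ∣) iX (proj₁ bB) (≤-reflexive ∣X∣+[∣B∣∸∣X∣]≡∣B∣)
    in T , indep-of-base-size⇒base bB iT (≡.trans ∣T∣≡∣B∣ ∣X∣+[∣B∣∸∣X∣]≡∣B∣) , X⊆T , T⊆X∪B
    where
    ∣X∣+[∣B∣∸∣X∣]≡∣B∣ : ∣ X ∣ + (∣ B ∣ ∸ ∣ X ∣) ≡ ∣ B ∣
    ∣X∣+[∣B∣∸∣X∣]≡∣B∣ = m+[n∸m]≡n (∣indep∣≤∣base∣ bB iX)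

  base? : ∀ X → Dec (IsBase M X)
  base? X = indep? X ×-dec maximal?
    where
    maximal? : Dec (∀ Y → X ⊂ Y → ¬ Indep Y)
    maximal? = map′ (λ ∄Y Y X⊂Y iY → ∄Y (Y , X⊂Y , iY)) (λ max (Y , X⊂Y , iY) → max Y X⊂Y iY)
                    (¬? (anySubset? λ Y → X ⊂? Y ×-dec indep? Y))

  module _ {A B} (A-base : IsBase M A) (B-base : IsBase M B) where

    ∣A─B∣≡∣B─A∣ : ∣ A ─ B ∣ ≡ ∣ B ─ A ∣
    ∣A─B∣≡∣B─A∣ = +-cancelˡ-≡ ∣ A ∩ B ∣ _ _ (begin
      ∣ A ∩ B ∣ + ∣ A ─ B ∣   ≡⟨ ∣p∣≡∣p∩q∣+∣p─q∣ A B ⟨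
      ∣ A ∣                   ≡⟨ ∣base∣≡∣base∣ A-base B-base ⟩
      ∣ B ∣                   ≡⟨ ∣p∣≡∣p∩q∣+∣p─q∣ B A ⟩
      ∣ B ∩ A ∣ + ∣ B ─ A ∣   ≡⟨ cong (λ p → ∣ p ∣ + ∣ B ─ A ∣) (∩-comm B A) ⟩
      ∣ A ∩ B ∣ + ∣ B ─ A ∣   ∎)
      where open ≡.≡-Reasoning

    base-meeting : ∀ {C} → A ∩ B ⊆ C → C ⊆ B → ∃ λ T → IsBase M T × T ∩ B ≡ C × T ⊆ A ∪ B
    base-meeting {C} A∩B⊆C C⊆B with extend-to-base A-base (indep-⊆ C⊆B (proj₁ B-base))
    ... | T , T-base , C⊆T , T⊆C∪A =
      T , T-base , ⊆-antisym T∩B⊆C (λ x∈C → x∈p∩q⁺ (C⊆T x∈C , C⊆B x∈C)) ,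
      ⊆-trans T⊆C∪A (p∪q⊆r (⊆-trans C⊆B (q⊆p∪q A B)) (p⊆p∪q B))
      where
      T∩B⊆C : T ∩ B ⊆ C
      T∩B⊆C x∈T∩B with x∈p∩q⁻ T B x∈T∩B
      ... | x∈T , x∈B with x∈p∪q⁻ C A (T⊆C∪A x∈T)
      ...   | inj₁ x∈C = x∈C
      ...   | inj₂ x∈A = A∩B⊆C (x∈p∩q⁺ (x∈A , x∈B))

    base-between : ∀ m → m ≤ ∣ A ─ B ∣ → ∃ λ T → IsBase M T × A ∩ B ⊆ T × T ⊆ A ∪ B × ∣ T ─ B ∣ ≡ m
    -- Keep A ∩ B and ∣A ─ B∣ − m elements B₂ of B ─ A, then complete to a base from A.
    base-between m m≤∣A─B∣
      with subset-of-size (B ─ A) (∣ A ─ B ∣ ∸ m) (≤-trans (m∸n≤m _ m) (≤-reflexive ∣A─B∣≡∣B─A∣))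
    ... | B₂ , B₂⊆B─A , ∣B₂∣≡∣A─B∣∸m
      with base-meeting (p⊆p∪q B₂) (p∪q⊆r (p∩q⊆q A B) (⊆-trans B₂⊆B─A (p─q⊆p B A)))
    ... | T , T-base , T∩B≡A∩B∪B₂ , T⊆A∪B =
      T , T-base , ⊆-trans (p⊆p∪q B₂) (subst (_⊆ T) T∩B≡A∩B∪B₂ (p∩q⊆p T B)) , T⊆A∪B ,
      +-cancelˡ-≡ (∣ A ─ B ∣ ∸ m) _ _ (+-cancelˡ-≡ ∣ A ∩ B ∣ _ _ (begin
        ∣ A ∩ B ∣ + (∣ A ─ B ∣ ∸ m + ∣ T ─ B ∣)   ≡⟨ +-assoc ∣ A ∩ B ∣ _ _ ⟨
        ∣ A ∩ B ∣ + (∣ A ─ B ∣ ∸ m) + ∣ T ─ B ∣   ≡⟨ cong (λ b → ∣ A ∩ B ∣ + b + ∣ T ─ B ∣) ∣B₂∣≡∣A─B∣∸m ⟨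
        ∣ A ∩ B ∣ + ∣ B₂ ∣ + ∣ T ─ B ∣             ≡⟨ cong (_+ ∣ T ─ B ∣) (∣p∪q∣≡∣p∣+∣q∣ (A ∩ B) B₂ A∩B#B₂) ⟨
        ∣ A ∩ B ∪ B₂ ∣ + ∣ T ─ B ∣                 ≡⟨ cong (λ c → ∣ c ∣ + ∣ T ─ B ∣) T∩B≡A∩B∪B₂ ⟨
        ∣ T ∩ B ∣ + ∣ T ─ B ∣                      ≡⟨ ∣p∣≡∣p∩q∣+∣p─q∣ T B ⟨
        ∣ T ∣                                      ≡⟨ ∣base∣≡∣base∣ T-base A-base ⟩
        ∣ A ∣                                      ≡⟨ ∣p∣≡∣p∩q∣+∣p─q∣ A B ⟩
        ∣ A ∩ B ∣ + ∣ A ─ B ∣                      ≡⟨ cong (∣ A ∩ B ∣ +_) (m∸n+n≡m m≤∣A─B∣) ⟨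
        ∣ A ∩ B ∣ + (∣ A ─ B ∣ ∸ m + m)            ∎))
      where
      open ≡.≡-Reasoning
      A∩B#B₂ : Disjoint (A ∩ B) B₂
      A∩B#B₂ x∈A∩B x∈B₂ = x∈p─q⇒x∉q (B₂⊆B─A x∈B₂) (p∩q⊆p A B x∈A∩B)

-- A subset S of Fin n is re-indexed by Fin ∣ S ∣: emb S lists S in increasing order, expand S
-- turns subsets of Fin ∣ S ∣ into subsets of S, and compress S restricts to S and re-indexes.
emb : ∀ {n} (S : Subset n) → Fin ∣ S ∣ → Fin n
emb (inside  ∷ S) zero    = zero
emb (inside  ∷ S) (suc j) = suc (emb S j)
emb (outside ∷ S) j       = suc (emb S j)

expand : ∀ {n} (S : Subset n) → Subset ∣ S ∣ → Subset n
expand []            []      = []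
expand (inside  ∷ S) (y ∷ Y) = y ∷ expand S Y
expand (outside ∷ S) Y       = outside ∷ expand S Y

compress : ∀ {n} (S : Subset n) → Subset n → Subset ∣ S ∣
compress []            []      = []
compress (inside  ∷ S) (x ∷ X) = x ∷ compress S X
compress (outside ∷ S) (_ ∷ X) = compress S X

emb∈S : ∀ {n} (S : Subset n) j → emb S j ∈ S
emb∈S (inside  ∷ S) zero    = here
emb∈S (inside  ∷ S) (suc j) = there (emb∈S S j)
emb∈S (outside ∷ S) j       = there (emb∈S S j)

emb∈expand⁺ : ∀ {n} (S : Subset n) {Y j} → j ∈ Y → emb S j ∈ expand S Y
emb∈expand⁺ (inside  ∷ S) here        = here
emb∈expand⁺ (inside  ∷ S) (there j∈Y) = there (emb∈expand⁺ S j∈Y)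
emb∈expand⁺ (outside ∷ S) j∈Y         = there (emb∈expand⁺ S j∈Y)

∈expand⁻ : ∀ {n} (S : Subset n) {Y x} → x ∈ expand S Y → ∃ λ j → j ∈ Y × emb S j ≡ x
∈expand⁻ (inside ∷ S) {_ ∷ _} here = zero , here , refl
∈expand⁻ (inside ∷ S) {_ ∷ _} (there x∈Y) =
  let j , j∈Y , emb≡x = ∈expand⁻ S x∈Y in suc j , there j∈Y , cong suc emb≡x
∈expand⁻ (outside ∷ S) (there x∈Y) =
  let j , j∈Y , emb≡x = ∈expand⁻ S x∈Y in j , j∈Y , cong suc emb≡x

expand⊆S : ∀ {n} (S : Subset n) {Y} → expand S Y ⊆ S
expand⊆S S x∈Y with ∈expand⁻ S x∈Y
... | j , _ , refl = emb∈S S j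

expand-mono : ∀ {n} (S : Subset n) {X Y} → X ⊆ Y → expand S X ⊆ expand S Y
expand-mono (inside  ∷ S) {_ ∷ _} {_ ∷ _} X⊆Y here with X⊆Y here
... | here = here
expand-mono (inside  ∷ S) {_ ∷ _} {_ ∷ _} X⊆Y (there x∈X) = there (expand-mono S (drop-∷-⊆ X⊆Y) x∈X)
expand-mono (outside ∷ S)                 X⊆Y (there x∈X) = there (expand-mono S X⊆Y x∈X)

expand-⊥ : ∀ {n} (S : Subset n) → expand S ⊥ ≡ ⊥
expand-⊥ []            = refl
expand-⊥ (inside  ∷ S) = cong (outside ∷_) (expand-⊥ S)
expand-⊥ (outside ∷ S) = cong (outside ∷_) (expand-⊥ S)

expand-∪ : ∀ {n} (S : Subset n) X Y → expand S (X ∪ Y) ≡ expand S X ∪ expand S Y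
expand-∪ []            []      []      = refl
expand-∪ (inside  ∷ S) (x ∷ X) (y ∷ Y) = cong (_ ∷_) (expand-∪ S X Y)
expand-∪ (outside ∷ S) X       Y       = cong (outside ∷_) (expand-∪ S X Y)

expand-⁅⁆ : ∀ {n} (S : Subset n) j → expand S ⁅ j ⁆ ≡ ⁅ emb S j ⁆
expand-⁅⁆ (inside  ∷ S) zero    = cong (inside ∷_) (expand-⊥ S)
expand-⁅⁆ (inside  ∷ S) (suc j) = cong (outside ∷_) (expand-⁅⁆ S j)
expand-⁅⁆ (outside ∷ S) j       = cong (outside ∷_) (expand-⁅⁆ S j)

∣expand∣ : ∀ {n} (S : Subset n) Y → ∣ expand S Y ∣ ≡ ∣ Y ∣
∣expand∣ []            []            = refl
∣expand∣ (inside  ∷ S) (inside  ∷ Y) = cong suc (∣expand∣ S Y)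
∣expand∣ (inside  ∷ S) (outside ∷ Y) = ∣expand∣ S Y
∣expand∣ (outside ∷ S) Y             = ∣expand∣ S Y

compress-expand : ∀ {n} (S : Subset n) Y → compress S (expand S Y) ≡ Y
compress-expand []            []      = refl
compress-expand (inside  ∷ S) (y ∷ Y) = cong (y ∷_) (compress-expand S Y)
compress-expand (outside ∷ S) Y       = compress-expand S Y

expand-compress : ∀ {n} (S : Subset n) {X} → X ⊆ S → expand S (compress S X) ≡ X
expand-compress []            {[]}          _   = refl
expand-compress (inside  ∷ S) {x ∷ X}       X⊆S = cong (x ∷_) (expand-compress S (drop-∷-⊆ X⊆S))
expand-compress (outside ∷ S) {outside ∷ X} X⊆S = cong (outside ∷_) (expand-compress S (drop-∷-⊆ X⊆S))
expand-compress (outside ∷ S) {inside  ∷ X} X⊆S with X⊆S here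
... | ()

∣compress∣ : ∀ {n} (S : Subset n) {X} → X ⊆ S → ∣ compress S X ∣ ≡ ∣ X ∣
∣compress∣ S {X} X⊆S = ≡.trans (≡.sym (∣expand∣ S (compress S X))) (cong ∣_∣ (expand-compress S X⊆S))

compress-⊥ : ∀ {n} (S : Subset n) → compress S ⊥ ≡ ⊥
compress-⊥ []            = refl
compress-⊥ (inside  ∷ S) = cong (outside ∷_) (compress-⊥ S)
compress-⊥ (outside ∷ S) = compress-⊥ S

compress-self : ∀ {n} (S : Subset n) → compress S S ≡ ⊤
compress-self []            = refl
compress-self (inside  ∷ S) = cong (inside ∷_) (compress-self S)
compress-self (outside ∷ S) = compress-self S

compress-∪ : ∀ {n} (S : Subset n) X Y → compress S (X ∪ Y) ≡ compress S X ∪ compress S Y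
compress-∪ []            []      []      = refl
compress-∪ (inside  ∷ S) (x ∷ X) (y ∷ Y) = cong (_ ∷_) (compress-∪ S X Y)
compress-∪ (outside ∷ S) (x ∷ X) (y ∷ Y) = compress-∪ S X Y

compress-∩ : ∀ {n} (S : Subset n) X Y → compress S (X ∩ Y) ≡ compress S X ∩ compress S Y
compress-∩ []            []      []      = refl
compress-∩ (inside  ∷ S) (x ∷ X) (y ∷ Y) = cong (_ ∷_) (compress-∩ S X Y)
compress-∩ (outside ∷ S) (x ∷ X) (y ∷ Y) = compress-∩ S X Y

compress-─ : ∀ {n} (S : Subset n) X Y → compress S (X ─ Y) ≡ compress S X ─ compress S Y
compress-─ []            []      []      = refl
compress-─ (inside  ∷ S) (x ∷ X) (y ∷ Y) = cong (_ ∷_) (compress-─ S X Y)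
compress-─ (outside ∷ S) (x ∷ X) (y ∷ Y) = compress-─ S X Y

-- The minor (M / C) | S, on the re-indexed ground set Fin ∣ S ∣.
module Contraction {n : ℕ} (M : Matroid n) (S C : Subset n) (S#C : Disjoint S C)
                   (C-indep : Matroid.Indep M C)
                   (S-nonloop : ∀ {x} → x ∈ S → Matroid.Indep M (⁅ x ⁆ ∪ C)) where
  open Matroid M
  open MatroidProperties
  open CommutativeSemigroupProperties
    (CommutativeMonoid.commutativeSemigroup (∪-commutativeMonoid n)) using (xy∙z≈xz∙y)

  ∣expand∪C∣ : ∀ Y → ∣ expand S Y ∪ C ∣ ≡ ∣ Y ∣ + ∣ C ∣
  ∣expand∪C∣ Y = ≡.trans (∣p∪q∣≡∣p∣+∣q∣ _ C (S#C ∘ expand⊆S S)) (cong (_+ ∣ C ∣) (∣expand∣ S Y))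

  minor-augment : ∀ {X Y} → Indep (expand S X ∪ C) → Indep (expand S Y ∪ C) → ∣ X ∣ < ∣ Y ∣ →
                  ∃ λ j → j ∈ Y × j ∉ X × Indep (expand S (X ∪ ⁅ j ⁆) ∪ C)
  minor-augment {X} {Y} iX iY ∣X∣<∣Y∣
    with augment iX iY (subst₂ _<_ (≡.sym (∣expand∪C∣ X)) (≡.sym (∣expand∪C∣ Y)) (+-monoˡ-< ∣ C ∣ ∣X∣<∣Y∣))
  ... | y , y∈Y∪C , y∉X∪C , iX∪C∪y with x∈p∪q⁻ (expand S Y) C y∈Y∪C
  ...   | inj₂ y∈C = ⊥-elim (y∉X∪C (q⊆p∪q _ C y∈C))
  ...   | inj₁ y∈Y with ∈expand⁻ S y∈Y
  ...     | j , j∈Y , refl =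
    j , j∈Y , (λ j∈X → y∉X∪C (p⊆p∪q C (emb∈expand⁺ S j∈X))) , subst Indep (≡.sym X∪j∪C≡X∪C∪j) iX∪C∪y
    where
    open ≡.≡-Reasoning
    X∪j∪C≡X∪C∪j : expand S (X ∪ ⁅ j ⁆) ∪ C ≡ (expand S X ∪ C) ∪ ⁅ emb S j ⁆
    X∪j∪C≡X∪C∪j = begin
      expand S (X ∪ ⁅ j ⁆) ∪ C              ≡⟨ cong (_∪ C) (expand-∪ S X ⁅ j ⁆) ⟩
      (expand S X ∪ expand S ⁅ j ⁆) ∪ C     ≡⟨ cong (λ e → (expand S X ∪ e) ∪ C) (expand-⁅⁆ S j) ⟩
      (expand S X ∪ ⁅ emb S j ⁆) ∪ C        ≡⟨ xy∙z≈xz∙y (expand S X) _ C ⟩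
      (expand S X ∪ C) ∪ ⁅ emb S j ⁆        ∎

  minor : Matroid ∣ S ∣
  minor = record
    { Indep    = λ Y → Indep (expand S Y ∪ C)
    ; indep?   = λ Y → indep? (expand S Y ∪ C)
    ; indep-∅  = subst Indep (≡.sym (≡.trans (cong (_∪ C) (expand-⊥ S)) (∪-identityˡ C))) C-indep
    ; indep-⊆  = λ X⊆Y → indep-⊆ (p∪q⊆r (⊆-trans (expand-mono S X⊆Y) (p⊆p∪q C)) (q⊆p∪q _ C))
    ; augment  = minor-augment
    ; loopless = λ j → subst Indep (cong (_∪ C) (≡.sym (expand-⁅⁆ S j))) (S-nonloop (emb∈S S j))
    }

  module _ {Z} (Z⊆S : Z ⊆ S) (Z∪C-base : IsBase M (Z ∪ C)) where

    ∣Z∪C∣ : ∣ Z ∪ C ∣ ≡ ∣ compress S Z ∣ + ∣ C ∣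
    ∣Z∪C∣ = ≡.trans (cong (λ W → ∣ W ∪ C ∣) (≡.sym (expand-compress S Z⊆S))) (∣expand∪C∣ (compress S Z))

    compress-base : IsBase minor (compress S Z)
    compress-base = indep-of-max-size⇒base minor compress-indep λ {Y} iY →
      +-cancelʳ-≤ ∣ C ∣ _ _ (≤-trans (≤-reflexive (≡.sym (∣expand∪C∣ Y)))
                                     (≤-trans (∣indep∣≤∣base∣ M Z∪C-base iY) (≤-reflexive ∣Z∪C∣)))
      where
      compress-indep : Indep (expand S (compress S Z) ∪ C)
      compress-indep = subst (λ W → Indep (W ∪ C)) (≡.sym (expand-compress S Z⊆S)) (proj₁ Z∪C-base)

    expand-base : ∀ {Y} → IsBase minor Y → IsBase M (expand S Y ∪ C)
    expand-base {Y} Y-base = indep-of-base-size⇒base M Z∪C-base (proj₁ Y-base) (begin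
      ∣ expand S Y ∪ C ∣          ≡⟨ ∣expand∪C∣ Y ⟩
      ∣ Y ∣ + ∣ C ∣               ≡⟨ cong (_+ ∣ C ∣) (∣base∣≡∣base∣ minor Y-base compress-base) ⟩
      ∣ compress S Z ∣ + ∣ C ∣    ≡⟨ ∣Z∪C∣ ⟨
      ∣ Z ∪ C ∣                   ∎)
      where open ≡.≡-Reasoning

module BlockMinor {n : ℕ} (M : Matroid n) {T B : Subset n} (T-base : IsBase M T) (B-base : IsBase M B) where
  open Matroid M
  open MatroidProperties

  S : Subset n
  S = (T ─ B) ∪ (B ─ T)

  S#T∩B : Disjoint S (T ∩ B)
  S#T∩B = Disjoint-∪ (λ x∈T─B x∈T∩B → x∈p─q⇒x∉q x∈T─B (p∩q⊆q T B x∈T∩B))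
                     (λ x∈B─T x∈T∩B → x∈p─q⇒x∉q x∈B─T (p∩q⊆p T B x∈T∩B))

  S-nonloop : ∀ {x} → x ∈ S → Indep (⁅ x ⁆ ∪ T ∩ B)
  S-nonloop x∈S with x∈p∪q⁻ (T ─ B) (B ─ T) x∈S
  ... | inj₁ x∈T─B = indep-⊆ (p∪q⊆r (x∈p⇒⁅x⁆⊆p (p─q⊆p T B x∈T─B)) (p∩q⊆p T B)) (proj₁ T-base)
  ... | inj₂ x∈B─T = indep-⊆ (p∪q⊆r (x∈p⇒⁅x⁆⊆p (p─q⊆p B T x∈B─T)) (p∩q⊆q T B)) (proj₁ B-base)

  open Contraction M S (T ∩ B) S#T∩B (indep-⊆ (p∩q⊆p T B) (proj₁ T-base)) S-nonloop public

  T′ B′ : Subset ∣ S ∣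
  T′ = compress S (T ─ B)
  B′ = compress S (B ─ T)

  B─T∪T∩B≡B : (B ─ T) ∪ (T ∩ B) ≡ B
  B─T∪T∩B≡B = ≡.trans (cong ((B ─ T) ∪_) (∩-comm T B)) (p─q∪p∩q≡p B T)

  expand-B′∪T∩B≡B : expand S B′ ∪ T ∩ B ≡ B
  expand-B′∪T∩B≡B = ≡.trans (cong (_∪ T ∩ B) (expand-compress S (q⊆p∪q (T ─ B) (B ─ T)))) B─T∪T∩B≡B

  T′-base : IsBase minor T′
  T′-base = compress-base (p⊆p∪q (B ─ T)) (subst (IsBase M) (≡.sym (p─q∪p∩q≡p T B)) T-base)

  B′-base : IsBase minor B′
  B′-base = compress-base (q⊆p∪q (T ─ B) (B ─ T)) (subst (IsBase M) (≡.sym B─T∪T∩B≡B) B-base)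

  blocks : IsBlockMatroidWithBlocks minor T′ B′
  blocks = T′-base , B′-base ,
    ≡.trans (≡.sym (compress-∩ S (T ─ B) (B ─ T)))
            (≡.trans (cong (compress S) (Disjoint⇒p∩q≡⊥ λ x∈T─B x∈B─T → x∈p─q⇒x∉q x∈T─B (p─q⊆p B T x∈B─T)))
                     (compress-⊥ S)) ,
    ≡.trans (≡.sym (compress-∪ S (T ─ B) (B ─ T))) (compress-self S)

  ∣T′∣≡∣T─B∣ : ∣ T′ ∣ ≡ ∣ T ─ B ∣
  ∣T′∣≡∣T─B∣ = ∣compress∣ S (p⊆p∪q (B ─ T))

  rank : HasRank minor ∣ T ─ B ∣
  rank Y Y-base = ≡.trans (∣base∣≡∣base∣ minor Y-base T′-base) ∣T′∣≡∣T─B∣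

  ∣T′─Y∣≡∣T─B─expand∣ : ∀ Y → ∣ T′ ─ Y ∣ ≡ ∣ T ─ B ─ expand S Y ∣
  ∣T′─Y∣≡∣T─B─expand∣ Y = begin
    ∣ T′ ─ Y ∣                                  ≡⟨ cong (λ Y′ → ∣ T′ ─ Y′ ∣) (compress-expand S Y) ⟨
    ∣ T′ ─ compress S (expand S Y) ∣            ≡⟨ cong ∣_∣ (compress-─ S (T ─ B) (expand S Y)) ⟨
    ∣ compress S (T ─ B ─ expand S Y) ∣         ≡⟨ ∣compress∣ S (⊆-trans (p─q⊆p (T ─ B) _) (p⊆p∪q (B ─ T))) ⟩
    ∣ T ─ B ─ expand S Y ∣                      ∎
    where open ≡.≡-Reasoning

module LabelSums {c ℓ : Level} (G : AbelianGroup c ℓ) where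
  open AbelianGroup G
    using (_≈_; _∙_; ε; ∙-congˡ; ∙-congʳ; assoc; identityˡ; commutativeSemigroup)
    renaming (Carrier to ∣G∣; refl to ≈-refl; sym to ≈-sym; trans to ≈-trans)
  open CommutativeSemigroupProperties commutativeSemigroup using (x∙yz≈y∙xz)

  labelSum-∪ : ∀ {n} (lab : Fin n → ∣G∣) (p q : Subset n) → Disjoint p q →
               labelSum G lab (p ∪ q) ≈ labelSum G lab p ∙ labelSum G lab q
  labelSum-∪ lab []            []            _   = ≈-sym (identityˡ ε)
  labelSum-∪ lab (inside  ∷ p) (inside  ∷ q) p#q = ⊥-elim (p#q here here)
  labelSum-∪ lab (inside  ∷ p) (outside ∷ q) p#q =
    ≈-trans (∙-congˡ (labelSum-∪ (lab ∘ suc) p q (Disjoint-tail p#q))) (≈-sym (assoc _ _ _))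
  labelSum-∪ lab (outside ∷ p) (inside  ∷ q) p#q =
    ≈-trans (∙-congˡ (labelSum-∪ (lab ∘ suc) p q (Disjoint-tail p#q))) (x∙yz≈y∙xz _ _ _)
  labelSum-∪ lab (outside ∷ p) (outside ∷ q) p#q = labelSum-∪ (lab ∘ suc) p q (Disjoint-tail p#q)

  labelSum-expand : ∀ {n} (lab : Fin n → ∣G∣) (S : Subset n) Y →
                    labelSum G (lab ∘ emb S) Y ≈ labelSum G lab (expand S Y)
  labelSum-expand lab []            []            = ≈-refl
  labelSum-expand lab (inside  ∷ S) (inside  ∷ Y) = ∙-congˡ (labelSum-expand (lab ∘ suc) S Y)
  labelSum-expand lab (inside  ∷ S) (outside ∷ Y) = labelSum-expand (lab ∘ suc) S Y
  labelSum-expand lab (outside ∷ S) Y             = labelSum-expand (lab ∘ suc) S Y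

  labelSum-expand-∪ : ∀ {n} (lab : Fin n → ∣G∣) {S C : Subset n} → Disjoint S C → ∀ Y →
                      labelSum G lab (expand S Y ∪ C) ≈ labelSum G (lab ∘ emb S) Y ∙ labelSum G lab C
  labelSum-expand-∪ lab {S} {C} S#C Y =
    ≈-trans (labelSum-∪ lab (expand S Y) C (S#C ∘ expand⊆S S)) (∙-congʳ (≈-sym (labelSum-expand lab S Y)))

-- Finiteness of G is used only to decide _≈_; then every search below is over the subsets of Fin n.
module FiniteLabelings {c ℓ : Level} (G : AbelianGroup c ℓ) (G-finite : IsFinite G) where
  open AbelianGroup G using (_≈_) renaming (Carrier to ∣G∣; refl to ≈-refl; sym to ≈-sym; trans to ≈-trans)
  open IsFinite G-finite

  _≈?_ : (x y : ∣G∣) → Dec (x ≈ y)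
  x ≈? y with onto x | onto y
  ... | i , i≈x | j , j≈y =
    map′ (λ { refl → ≈-trans (≈-sym i≈x) j≈y }) (λ x≈y → inject i j (≈-trans i≈x (≈-trans x≈y (≈-sym j≈y)))) (i ≟ j)

  module _ {n : ℕ} (M : Matroid n) (lab : Fin n → ∣G∣) where
    open MatroidProperties M using (base?)

    gBase? : ∀ g X → Dec (IsGBase G M lab g X)
    gBase? g X = base? X ×-dec (labelSum G lab X ≈? g)

    NearGBase : ℕ → ∣G∣ → Subset n → Set ℓ
    NearGBase k g A = ∃ λ B → IsGBase G M lab g B × dist M A B ≤ k

    nearGBase? : ∀ k g A → Dec (NearGBase k g A)
    nearGBase? k g A = anySubset? λ B → gBase? g B ×-dec (dist M A B ≤? k)

    far-base : ∀ k → ¬ KCloseLabeling G M lab k →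
               ∃ λ g → ∃ λ A → (∃ λ X → IsGBase G M lab g X) × IsBase M A ×
                               (∀ B → IsGBase G M lab g B → k < dist M A B)
    -- A value admitting a g-base is the sum of a base, so the bad value is searched among those sums.
    far-base k not-close
      with anySubset? (λ X → base? X ×-dec anySubset? λ A → base? A ×-dec ¬? (nearGBase? k (labelSum G lab X) A))
    ... | yes (X , X-base , A , A-base , ¬near) =
      labelSum G lab X , A , (X , X-base , ≈-refl) , A-base , λ B B-gbase → ≰⇒> λ near → ¬near (B , B-gbase , near)
    ... | no ∄far = ⊥-elim (not-close λ g (X , X-base , ℓX≈g) A A-base →
      let B , (B-base , ℓB≈ℓX) , near = decidable-stable (nearGBase? k (labelSum G lab X) A)
                                          λ ¬near → ∄far (X , X-base , A , A-base , ¬near)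
      in B , (B-base , ≈-trans ℓB≈ℓX ℓX≈g) , near)

    closest-gbase : ∀ g A {X} → IsGBase G M lab g X → ∃ λ B → ClosestGBase G M lab g A B
    closest-gbase g A X-gbase = descend X-gbase (<-wellFounded _)
      where
      descend : ∀ {X} → IsGBase G M lab g X → Acc _<_ (dist M A X) → ∃ λ B → ClosestGBase G M lab g A B
      descend {X} X-gbase (acc closer)
        with anySubset? (λ Y → gBase? g Y ×-dec (dist M A Y <? dist M A X))
      ... | yes (Y , Y-gbase , Y-closer) = descend Y-gbase (closer Y-closer)
      ... | no ∄closer = X , X-gbase , λ Y Y-gbase → ≮⇒≥ λ Y-closer → ∄closer (Y , Y-gbase , Y-closer)

BlockCounterexample : ∀ {c ℓ : Level} → AbelianGroup c ℓ → ℕ → Set (lsuc 0ℓ ⊔ c ⊔ ℓ)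
BlockCounterexample G k =
  Σ ℕ λ n → Σ (Matroid n) λ M →
  Σ (Subset n) λ A → Σ (Subset n) λ B →
  Σ (Fin n → AbelianGroup.Carrier G) λ lab → Σ (AbelianGroup.Carrier G) λ g →
    IsBlockMatroidWithBlocks M A B × HasRank M (suc k) ×
    ClosestGBase G M lab g A B × k < dist M A B

module Reduction {c ℓ : Level} (G : AbelianGroup c ℓ) {n : ℕ} (M : Matroid n)
                 (lab : Fin n → AbelianGroup.Carrier G) (g : AbelianGroup.Carrier G)
                 {A B T : Subset n} (B-closest : ClosestGBase G M lab g A B)
                 (T-base : IsBase M T) (A∩B⊆T : A ∩ B ⊆ T) (T⊆A∪B : T ⊆ A ∪ B)
                 (k : ℕ) (∣T─B∣≡1+k : ∣ T ─ B ∣ ≡ suc k) where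
  open AbelianGroup G using (_≈_; _∙_; ∙-congʳ; setoid; group)
    renaming (Carrier to ∣G∣; refl to ≈-refl; sym to ≈-sym)
  open Group group using (_//_)
  open GroupProperties group using (//-rightDividesˡ; //-rightDividesʳ; //-cong₂)
  open LabelSums G

  B-base : IsBase M B
  B-base = proj₁ (proj₁ B-closest)

  open BlockMinor M T-base B-base

  ℓC : ∣G∣
  ℓC = labelSum G lab (T ∩ B)

  lab′ : Fin ∣ S ∣ → ∣G∣
  lab′ = lab ∘ emb S

  g′ : ∣G∣
  g′ = g // ℓC

  lift-gbase : ∀ {Y} → IsGBase G minor lab′ g′ Y → IsGBase G M lab g (expand S Y ∪ T ∩ B)
  lift-gbase {Y} (Y-base , ℓY≈g′) =
    expand-base (p⊆p∪q (B ─ T)) (subst (IsBase M) (≡.sym (p─q∪p∩q≡p T B)) T-base) Y-base , (begin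
      labelSum G lab (expand S Y ∪ T ∩ B)   ≈⟨ labelSum-expand-∪ lab S#T∩B Y ⟩
      labelSum G lab′ Y ∙ ℓC                ≈⟨ ∙-congʳ ℓY≈g′ ⟩
      (g // ℓC) ∙ ℓC                        ≈⟨ //-rightDividesˡ ℓC g ⟩
      g                                     ∎)
    where open import Relation.Binary.Reasoning.Setoid setoid

  B′-gbase : IsGBase G minor lab′ g′ B′
  B′-gbase = B′-base , (begin
    labelSum G lab′ B′                           ≈⟨ //-rightDividesʳ ℓC _ ⟨
    (labelSum G lab′ B′ ∙ ℓC) // ℓC              ≈⟨ //-cong₂ (≈-sym (labelSum-expand-∪ lab S#T∩B B′)) ≈-refl ⟩
    labelSum G lab (expand S B′ ∪ T ∩ B) // ℓC   ≡⟨ cong (λ W → labelSum G lab W // ℓC) expand-B′∪T∩B≡B ⟩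
    labelSum G lab B // ℓC                       ≈⟨ //-cong₂ (proj₂ (proj₁ B-closest)) ≈-refl ⟩
    g′                                           ∎)
    where open import Relation.Binary.Reasoning.Setoid setoid

  A₂ : Subset n
  A₂ = (A ─ B) ─ (T ─ B)

  T─B⊆A─B : T ─ B ⊆ A ─ B
  T─B⊆A─B x∈T─B with x∈p∪q⁻ A B (T⊆A∪B (p─q⊆p T B x∈T─B))
  ... | inj₁ x∈A = x∈p∧x∉q⇒x∈p─q x∈A (x∈p─q⇒x∉q x∈T─B)
  ... | inj₂ x∈B = ⊥-elim (x∈p─q⇒x∉q x∈T─B x∈B)

  ∣A─B∣≡1+k+∣A₂∣ : ∣ A ─ B ∣ ≡ suc k + ∣ A₂ ∣
  ∣A─B∣≡1+k+∣A₂∣ = begin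
    ∣ A ─ B ∣                         ≡⟨ ∣p∣≡∣p∩q∣+∣p─q∣ (A ─ B) (T ─ B) ⟩
    ∣ (A ─ B) ∩ (T ─ B) ∣ + ∣ A₂ ∣    ≡⟨ cong (λ p → ∣ p ∣ + ∣ A₂ ∣) A─B∩T─B≡T─B ⟩
    ∣ T ─ B ∣ + ∣ A₂ ∣                ≡⟨ cong (_+ ∣ A₂ ∣) ∣T─B∣≡1+k ⟩
    suc k + ∣ A₂ ∣                    ∎
    where
    open ≡.≡-Reasoning
    A─B∩T─B≡T─B : (A ─ B) ∩ (T ─ B) ≡ T ─ B
    A─B∩T─B≡T─B = ⊆-antisym (p∩q⊆q (A ─ B) (T ─ B)) (λ x∈T─B → x∈p∩q⁺ (T─B⊆A─B x∈T─B , x∈T─B))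

  A─lift⊆T─B─Y∪A₂ : ∀ Y → A ─ (expand S Y ∪ T ∩ B) ⊆ (T ─ B ─ expand S Y) ∪ A₂
  A─lift⊆T─B─Y∪A₂ Y {x} x∈A─W with x ∈? (T ─ B)
  ... | yes x∈T─B = p⊆p∪q A₂ (x∈p∧x∉q⇒x∈p─q x∈T─B (x∉W ∘ p⊆p∪q (T ∩ B)))
    where
    x∉W : x ∉ expand S Y ∪ T ∩ B
    x∉W = x∈p─q⇒x∉q x∈A─W
  ... | no x∉T─B = q⊆p∪q _ A₂ (x∈p∧x∉q⇒x∈p─q (x∈p∧x∉q⇒x∈p─q x∈A x∉B) x∉T─B)
    where
    x∈A : x ∈ A
    x∈A = p─q⊆p A _ x∈A─W
    x∉B : x ∉ B
    x∉B x∈B = x∈p─q⇒x∉q x∈A─W (q⊆p∪q _ (T ∩ B) (x∈p∩q⁺ (A∩B⊆T (x∈p∩q⁺ (x∈A , x∈B)) , x∈B)))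

  far-from-T′ : ∀ {Y} → IsGBase G minor lab′ g′ Y → suc k ≤ dist minor T′ Y
  far-from-T′ {Y} Y-gbase = +-cancelʳ-≤ ∣ A₂ ∣ _ _ (begin
    suc k + ∣ A₂ ∣                              ≡⟨ ∣A─B∣≡1+k+∣A₂∣ ⟨
    ∣ A ─ B ∣                                   ≤⟨ proj₂ B-closest _ (lift-gbase Y-gbase) ⟩
    ∣ A ─ (expand S Y ∪ T ∩ B) ∣                ≤⟨ p⊆q⇒∣p∣≤∣q∣ (A─lift⊆T─B─Y∪A₂ Y) ⟩
    ∣ (T ─ B ─ expand S Y) ∪ A₂ ∣               ≤⟨ ∣p∪q∣≤∣p∣+∣q∣ (T ─ B ─ expand S Y) A₂ ⟩
    ∣ T ─ B ─ expand S Y ∣ + ∣ A₂ ∣             ≡⟨ cong (_+ ∣ A₂ ∣) (∣T′─Y∣≡∣T─B─expand∣ Y) ⟨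
    ∣ T′ ─ Y ∣ + ∣ A₂ ∣                         ∎)
    where open ≤-Reasoning

  counterexample : BlockCounterexample G k
  counterexample =
    ∣ S ∣ , minor , T′ , B′ , lab′ , g′ , blocks , subst (HasRank minor) ∣T─B∣≡1+k rank ,
    (B′-gbase , λ Y Y-gbase → ≤-trans (p⊆q⇒∣p∣≤∣q∣ (p─q⊆p T′ B′))
                                (≤-trans (≤-reflexive (≡.trans ∣T′∣≡∣T─B∣ ∣T─B∣≡1+k)) (far-from-T′ Y-gbase))) ,
    far-from-T′ B′-gbase

corollary2 : ∀ {c ℓ : Level} (G : AbelianGroup c ℓ) → IsFinite G → (k : ℕ) →
    NotKClose G k →
    Σ ℕ λ n → Σ (Matroid n) λ M →
    Σ (Subset n) λ A → Σ (Subset n) λ B →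
    Σ (Fin n → AbelianGroup.Carrier G) λ lab → Σ (AbelianGroup.Carrier G) λ g →
      IsBlockMatroidWithBlocks M A B × HasRank M (suc k) ×
      ClosestGBase G M lab g A B × k < dist M A B
corollary2 G G-finite k (n , M , lab , not-close) =
  let open FiniteLabelings G G-finite
      g , A , (X , X-gbase) , A-base , far = far-base M lab k not-close
      B , B-closest = closest-gbase M lab g A X-gbase
      T , T-base , A∩B⊆T , T⊆A∪B , ∣T─B∣≡1+k =
        MatroidProperties.base-between M A-base (proj₁ (proj₁ B-closest)) (suc k) (far B (proj₁ B-closest))
  in Reduction.counterexample G M lab g B-closest T-base A∩B⊆T T⊆A∪B k ∣T─B∣≡1+k
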